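{- Let $w\in S_n$ and let $P = x_{i_1j_1}\cdots x_{i_\ell j_\ell}$ be a monomial with $i_k<j_k$ for all $k$. Let $v_k = s_{i_kj_k}s_{i_{k+1}j_{k+1}}\cdots s_{i_\ell j_\ell}$. Then $\langle x_w, P\rangle = 1$ if $\mathrm{id}\lessdot v_\ell\lessdot v_{\ell-1}\lessdot\cdots\lessdot v_1 = w^{ -1}$ is a saturated chain in the Bruhat order of $S_n$, and $\langle x_w,P\rangle = 0$ otherwise. In particular, for $v,w\in S_n$, $\langle x_v,x_w\rangle = 1$ if $w = v^{ -1}$ and $0$ otherwise.
   Context: $S_n$ is the symmetric group, $s_{ij}$ the transposition of $i,j$, $s_i=s_{i,i+1}$; in Bruhat order $u\lessdot u'$ means $\ell(u) = \ell(u')-1$ and $u = u's_{ij}$ for some transposition. The Fomin–Kirillov algebra $\mathcal{E}_n$ is the complex algebra generated by $x_{ij}$ for distinct $i,j$ with $x_{ij}=-x_{ji}$, subject to $x_{ij}^2=0$, $x_{ij}x_{kl}=x_{kl}x_{ij}$, $x_{ij}x_{jk}+x_{jk}x_{ki}+x_{ki}x_{ij}=0$ for distinct $i,j,k,l$. $S_n$ acts by automorphisms via $w(x_{ij}) = x_{w(i)w(j)}$. For $w$ with reduced expression $s_{i_1}\cdots s_{i_\ell}$, $x_w = x_{i_1,i_1+1}\cdots x_{i_\ell,i_\ell+1}$. For distinct $a,b$, $\Delta_{ab}$ is the linear map $\mathcal{E}_n\to\mathcal{E}_n$ with $\Delta_{ab}(x_{ij}) = 1$ if $(i,j)=(a,b)$,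 $-1$ if $(i,j)=(b,a)$, $0$ otherwise, and $\Delta_{ab}(PQ) = \Delta_{ab}(P)Q + s_{ab}(P)\Delta_{ab}(Q)$; for a monomial $P=x_{i_1j_1}\cdots x_{i_kj_k}$, $\Delta_P = \Delta_{i_1j_1}\circ\cdots\circ\Delta_{i_kj_k}$, extended linearly in $P$. The bilinear form $\langle P,Q\rangle$ is the degree-zero (scalar) component of $\Delta_P(Q)$; it is symmetric, vanishes unless $P,Q$ have matching degree, and for homogeneous $P,Q$ of equal degree equals $(Q)\nabla_P$, where $\nabla$ is the dual right action with $(x_{ij})\nabla_{ab} = \Delta_{ab}(x_{ij})$, $(PQ)\nabla_{ab} = P\cdot(Q)\nabla_{ab} + (P)\nabla_{s_Q(a)s_Q(b)}\cdot Q$ ($s_Q$ the $S_n$-degree of homogeneous $Q$, i.e. the product of the transpositions of its variables) and $(R)\nabla_{x_{i_1j_1}\cdots x_{i_kj_k}} = (\cdots(R)\nabla_{i_1j_1}\cdots)\nabla_{i_kj_k}$. -}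

module Defs where

open import Data.Nat as ℕ using (ℕ; zero; suc)
open import Data.Integer as ℤ using (ℤ; +_; -_; 0ℤ; 1ℤ)
open import Data.Fin using (Fin; toℕ; _<_; _≟_)
open import Data.Fin.Permutation using (Permutation′; _⟨$⟩ʳ_; _≈_; id; flip; _∘ₚ_; transpose)
open import Data.List using (List; []; _∷_; map; concatMap; length; filter; foldr; allFin)
  renaming (sum to lsum)
open import Data.List.Relation.Unary.All using (All)
open import Data.Product using (_×_; _,_; ∃; ∃-syntax; Σ)
open import Data.Unit using (⊤)
open import Data.Bool using (Bool; true; false; _∧_; if_then_else_)
open import Relation.Nullary.Decidable using (⌊_⌋; _×-dec_)
open import Relation.Binary.PropositionalEquality using (_≡_)
open import Data.Fin.Properties using (_<?_)

-- Functional product: (u · v)(k) = u (v k).  (stdlib's _∘ₚ_ is diagrammatic)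
infixl 7 _·_
_·_ : ∀ {n} → Permutation′ n → Permutation′ n → Permutation′ n
u · v = v ∘ₚ u

_⁻¹ : ∀ {n} → Permutation′ n → Permutation′ n
u ⁻¹ = flip u

s : ∀ {n} → Fin n → Fin n → Permutation′ n
s i j = transpose i j

allPairs : ∀ n → List (Fin n × Fin n)
allPairs n = concatMap (λ i → map (λ j → (i , j)) (allFin n)) (allFin n)

len : ∀ {n} → Permutation′ n → ℕ
len {n} u = length (filter (λ { (i , j) → (i <? j) ×-dec ((u ⟨$⟩ʳ j) <? (u ⟨$⟩ʳ i)) }) (allPairs n))

_⋖_ : ∀ {n} → Permutation′ n → Permutation′ n → Set
_⋖_ {n} u u' = (suc (len u) ≡ len u') × ∃[ i ] ∃[ j ] (i < j × (u ≈ u' · s i j))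

-- Monomials in the generators x_{ij} (words of ordered pairs), and
-- integer linear combinations of monomials (elements of the free algebra;
-- the twisted derivations Δ_{ab} descend to the Fomin–Kirillov algebra).

Gen : ℕ → Set
Gen n = Fin n × Fin n

Mono : ℕ → Set
Mono n = List (Gen n)

Lin : ℕ → Set
Lin n = List (ℤ × Mono n)

eqF : ∀ {n} → Fin n → Fin n → Bool
eqF i j = ⌊ i ≟ j ⌋

δ : ∀ {n} → Fin n → Fin n → Gen n → ℤ
δ a b (i , j) =
  if eqF i a ∧ eqF j b then 1ℤ
  else if eqF i b ∧ eqF j a then - 1ℤ
  else 0ℤ

actGen : ∀ {n} → Permutation′ n → Gen n → Gen n
actGen w (i , j) = (w ⟨$⟩ʳ i , w ⟨$⟩ʳ j)

Δmono : ∀ {n} → Fin n → Fin n → Mono n → Lin n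
Δmono a b [] = []
Δmono a b (g ∷ m) =
  (δ a b g , m) ∷ map (λ { (c , m') → (c , actGen (s a b) g ∷ m') }) (Δmono a b m)

Δ : ∀ {n} → Fin n → Fin n → Lin n → Lin n
Δ a b L = concatMap (λ { (c , m) → map (λ { (c' , m') → (c ℤ.* c' , m') }) (Δmono a b m) }) L

ΔP : ∀ {n} → Mono n → Lin n → Lin n
ΔP [] L = L
ΔP ((a , b) ∷ P) L = Δ a b (ΔP P L)

scalar : ∀ {n} → Lin n → ℤ
scalar [] = 0ℤ
scalar ((c , []) ∷ L) = c ℤ.+ scalar L
scalar ((c , _ ∷ _) ∷ L) = scalar L

⟨_,_⟩ : ∀ {n} → Mono n → Mono n → ℤ
⟨ P , Q ⟩ = scalar (ΔP P ((1ℤ , Q) ∷ []))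

Adjacent : ∀ {n} → Gen n → Set
Adjacent (i , j) = toℕ j ≡ suc (toℕ i)

prodT : ∀ {n} → Mono n → Permutation′ n
prodT [] = id
prodT ((i , j) ∷ P) = s i j · prodT P

-- word is a reduced expression s_{i_1} ⋯ s_{i_ℓ} of w
-- (given as the list of adjacent pairs (i_k , i_k + 1));
-- x_w is then the monomial 'word' itself.
ReducedWord : ∀ {n} → Permutation′ n → Mono n → Set
ReducedWord w word = All Adjacent word × (prodT word ≈ w) × (length word ≡ len w)

-- The saturated chain condition for P = x_{i_1 j_1} ⋯ x_{i_ℓ j_ℓ}:
-- v_k = s_{i_k j_k} ⋯ s_{i_ℓ j_ℓ} = prodT (drop (k-1) P), v_{ℓ+1} = id, and
-- id ⋖ v_ℓ ⋖ ⋯ ⋖ v_1.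
Covers : ∀ {n} → Mono n → Set
Covers [] = ⊤
Covers (g ∷ P) = (prodT P ⋖ prodT (g ∷ P)) × Covers P

SatChain : ∀ {n} → Permutation′ n → Mono n → Set
SatChain w P = Covers P × (prodT P ≈ w ⁻¹)

IncreasingPairs : ∀ {n} → Mono n → Set
IncreasingPairs P = All (λ { (i , j) → i < j }) P

module Submission where

-- A word P = x_{g₁} ⋯ x_{gₖ} in the generators (pairs in either order, x_{ji} = -x_{ij}) is
-- measured by its sign, the parity of its decreasing pairs, and by whether its transpositions
-- peel off a saturated chain T ⋗ s_{g₁}T ⋗ ⋯ ⋗ id in Bruhat order.  For every reduced word W
-- we show ⟨W, P⟩ = sign(P) when P is such a chain from T = (prod W)⁻¹, and 0 otherwise.
--
-- The induction removes the last letter s_a of W, whose Δ acts first: ⟨W' s_a, P⟩ is the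
-- functional ⟨W', -⟩ evaluated on Δ_{a,a+1}(P), and reducedness makes a a left descent of T.
-- Expanding Δ_{a,a+1}(P) by its twisted Leibniz rule, the first letter g of P contributes
-- either through δ(g), when g = ±x_{a,a+1}, or through the letter s_a(g) of the remaining sum.
-- The lifting property of Bruhat order matches the covers T ⋗ s_g T and s_a T ⋗ s_a s_g T, so
-- exactly the chain terms survive; when a is not a descent, the contributions cancel or vanish.
-- The second statement is the case P = x_w: the letters of a reduced word always form a chain,
-- from w down to id, so x_w is a chain from v⁻¹ exactly when w = v⁻¹.

open import Defs
open import Data.Nat as ℕ using (ℕ; zero; suc; _+_; _≤_; s≤s)
import Data.Nat.Properties as ℕP
open import Data.Fin as F using (Fin; toℕ)
open import Data.Fin.Properties using (_<?_)
import Data.Fin.Properties as FP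
open import Data.Fin.Permutation as Perm using (Permutation′; _⟨$⟩ʳ_; _≈_; id)
import Data.Fin.Permutation.Components as PC
open import Data.Integer as ℤ using (ℤ; 0ℤ; 1ℤ; -_)
import Data.Integer.Properties as ℤP
open import Data.Integer.Tactic.RingSolver using (solve-∀)
open import Data.Bool using (true; false; _∧_)
open import Data.List using (List; []; _∷_; _++_; _∷ʳ_; map; length; filter; tabulate; concatMap; allFin)
import Data.List.Properties as LP
open import Data.List.Relation.Unary.All using (All; []; _∷_)
import Data.List.Relation.Unary.All.Properties as AllP
open import Data.List.Reverse using (Reverse; []; _∶_∶ʳ_; reverseView)
open import Data.Product using (_×_; _,_; proj₁; proj₂; uncurry)
open import Data.Sum using (_⊎_; inj₁; inj₂)
open import Data.Empty using (⊥; ⊥-elim)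
open import Function using (_∘_; case_of_)
open import Relation.Binary using (Tri; tri<; tri≈; tri>)
open import Relation.Binary.PropositionalEquality
open import Relation.Nullary using (¬_; Dec; yes; no)
open import Relation.Nullary.Decidable
  using (_×-dec_; _⊎-dec_; dec-true; dec-false; isYes≗does; decidable-stable)
open import Relation.Unary using (Pred; Decidable)
open import Algebra.Properties.CommutativeMonoid.Sum ℕP.+-0-commutativeMonoid
  using (sum; sum-remove; ∑-comm; ∑-permute; sum-cong-≗; sum-replicate-zero)
open import Algebra.Properties.CommutativeSemigroup ℤP.*-commutativeSemigroup using (x∙yz≈y∙xz)

indicator : ∀ {p} {P : Set p} → Dec P → ℕ
indicator (yes _) = 1
indicator (no _) = 0

indicator-yes : ∀ {p} {P : Set p} → P → (P? : Dec P) → indicator P? ≡ 1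
indicator-yes x (yes _) = refl
indicator-yes x (no ¬x) = ⊥-elim (¬x x)

indicator-no : ∀ {p} {P : Set p} → ¬ P → (P? : Dec P) → indicator P? ≡ 0
indicator-no ¬x (yes x) = ⊥-elim (¬x x)
indicator-no ¬x (no _) = refl

indicator-cong : ∀ {p q} {P : Set p} {Q : Set q} → (P → Q) → (Q → P) →
                 (P? : Dec P) (Q? : Dec Q) → indicator P? ≡ indicator Q?
indicator-cong f g (yes p) (yes q) = refl
indicator-cong f g (yes p) (no ¬q) = ⊥-elim (¬q (f p))
indicator-cong f g (no ¬p) (yes q) = ⊥-elim (¬p (g q))
indicator-cong f g (no ¬p) (no ¬q) = refl

module _ {a p} {A : Set a} {P : Pred A p} (P? : Decidable P) where

  length-filter-tabulate : ∀ {n} (h : Fin n → A) →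
    length (filter P? (tabulate h)) ≡ sum (λ i → indicator (P? (h i)))
  length-filter-tabulate {zero} h = refl
  length-filter-tabulate {suc n} h with P? (h F.zero)
  ... | yes _ = cong suc (length-filter-tabulate (h ∘ F.suc))
  ... | no _ = length-filter-tabulate (h ∘ F.suc)

  length-filter-concatMap : ∀ {b} {B : Set b} (f : B → List A) {n} (h : Fin n → B) →
    length (filter P? (concatMap f (tabulate h))) ≡ sum (λ i → length (filter P? (f (h i))))
  length-filter-concatMap f {zero} h = refl
  length-filter-concatMap f {suc n} h = begin
    length (filter P? (f (h F.zero) ++ rest))
      ≡⟨ cong length (LP.filter-++ P? (f (h F.zero)) rest) ⟩
    length (filter P? (f (h F.zero)) ++ filter P? rest)
      ≡⟨ LP.length-++ (filter P? (f (h F.zero))) ⟩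
    length (filter P? (f (h F.zero))) + length (filter P? rest)
      ≡⟨ cong (length (filter P? (f (h F.zero))) +_) (length-filter-concatMap f (h ∘ F.suc)) ⟩
    _ ∎
    where
    open ≡-Reasoning
    rest = concatMap f (tabulate (h ∘ F.suc))

∑∑ : ∀ {n} → (Fin n → Fin n → ℕ) → ℕ
∑∑ f = sum (λ i → sum (f i))

∑∑-cong : ∀ {n} {f g : Fin n → Fin n → ℕ} → (∀ i j → f i j ≡ g i j) → ∑∑ f ≡ ∑∑ g
∑∑-cong f≡g = sum-cong-≗ (λ i → sum-cong-≗ (f≡g i))

∑∑-permute : ∀ {n} (σ : Permutation′ n) (f : Fin n → Fin n → ℕ) →
             ∑∑ f ≡ ∑∑ (λ i j → f (σ ⟨$⟩ʳ i) (σ ⟨$⟩ʳ j))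
∑∑-permute σ f =
  trans (∑-permute (λ i → sum (f i)) σ) (sum-cong-≗ (λ i → ∑-permute (f (σ ⟨$⟩ʳ i)) σ))

sum-update : ∀ {n} (f g : Fin n → ℕ) (i₀ : Fin n) → (∀ i → i ≢ i₀ → f i ≡ g i) →
             sum f + g i₀ ≡ sum g + f i₀
sum-update {suc n} f g i₀ f≡g = begin
  sum f + g i₀                                 ≡⟨ cong (_+ g i₀) (sum-remove f) ⟩
  f i₀ + sum (f ∘ F.punchIn i₀) + g i₀         ≡⟨ cong (λ t → f i₀ + t + g i₀) rest ⟩
  f i₀ + sum (g ∘ F.punchIn i₀) + g i₀         ≡⟨ ℕP.+-comm (f i₀ + _) (g i₀) ⟩
  g i₀ + (f i₀ + sum (g ∘ F.punchIn i₀))       ≡⟨ cong (g i₀ +_) (ℕP.+-comm (f i₀) _) ⟩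
  g i₀ + (sum (g ∘ F.punchIn i₀) + f i₀)       ≡⟨ ℕP.+-assoc (g i₀) _ (f i₀) ⟨
  g i₀ + sum (g ∘ F.punchIn i₀) + f i₀         ≡⟨ cong (_+ f i₀) (sum-remove g) ⟨
  sum g + f i₀                                 ∎
  where
  open ≡-Reasoning
  rest = sum-cong-≗ (λ k → f≡g (F.punchIn i₀ k) (FP.punchInᵢ≢i i₀ k))

∑∑-update : ∀ {n} (f g : Fin n → Fin n → ℕ) (i₀ j₀ : Fin n) →
            (∀ i j → ¬ (i ≡ i₀ × j ≡ j₀) → f i j ≡ g i j) →
            ∑∑ f + g i₀ j₀ ≡ ∑∑ g + f i₀ j₀
∑∑-update f g i₀ j₀ f≡g = ℕP.+-cancelʳ-≡ (sum (g i₀)) _ _ (begin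
  ∑∑ f + g₀ + G  ≡⟨ ℕP.+-assoc (∑∑ f) g₀ G ⟩
  ∑∑ f + (g₀ + G) ≡⟨ cong (∑∑ f +_) (ℕP.+-comm g₀ G) ⟩
  ∑∑ f + (G + g₀) ≡⟨ ℕP.+-assoc (∑∑ f) G g₀ ⟨
  ∑∑ f + G + g₀  ≡⟨ cong (_+ g₀) rows ⟩
  ∑∑ g + F + g₀  ≡⟨ ℕP.+-assoc (∑∑ g) F g₀ ⟩
  ∑∑ g + (F + g₀) ≡⟨ cong (∑∑ g +_) row ⟩
  ∑∑ g + (G + f₀) ≡⟨ cong (∑∑ g +_) (ℕP.+-comm G f₀) ⟩
  ∑∑ g + (f₀ + G) ≡⟨ ℕP.+-assoc (∑∑ g) f₀ G ⟨
  ∑∑ g + f₀ + G  ∎)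
  where
  open ≡-Reasoning
  F = sum (f i₀)
  G = sum (g i₀)
  f₀ = f i₀ j₀
  g₀ = g i₀ j₀
  rows : ∑∑ f + G ≡ ∑∑ g + F
  rows = sum-update (sum ∘ f) (sum ∘ g) i₀
    (λ i i≢i₀ → sum-cong-≗ (λ j → f≡g i j (i≢i₀ ∘ proj₁)))
  row : F + g₀ ≡ G + f₀
  row = sum-update (f i₀) (g i₀) j₀ (λ j j≢j₀ → f≡g i₀ j (j≢j₀ ∘ proj₂))

-- Permutations, transpositions and length

infixr 20 _∙_
_∙_ : ∀ {n} → Permutation′ n → Fin n → Fin n
u ∙ x = u ⟨$⟩ʳ x

module _ {n : ℕ} where

  ∙-injective : (u : Permutation′ n) {x y : Fin n} → u ∙ x ≡ u ∙ y → x ≡ y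
  ∙-injective u eq = trans (sym (Perm.inverseˡ u)) (trans (cong ((u ⁻¹) ∙_) eq) (Perm.inverseˡ u))

  ∙≡⇒≡⁻¹∙ : (u : Permutation′ n) {x y : Fin n} → u ∙ x ≡ y → x ≡ (u ⁻¹) ∙ y
  ∙≡⇒≡⁻¹∙ u eq = trans (sym (Perm.inverseˡ u)) (cong ((u ⁻¹) ∙_) eq)

  ⁻¹-cong : {u v : Permutation′ n} → u ≈ v → u ⁻¹ ≈ v ⁻¹
  ⁻¹-cong {u = u} {v = v} u≈v x =
    ∙-injective u (trans (Perm.inverseʳ u) (trans (sym (Perm.inverseʳ v)) (sym (u≈v _))))

  data TransposeView (i j k : Fin n) : Set where
    at-i : k ≡ i → TransposeView i j k
    at-j : k ≢ i → k ≡ j → TransposeView i j k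
    away : k ≢ i → k ≢ j → TransposeView i j k

  transposeView : (i j k : Fin n) → TransposeView i j k
  transposeView i j k with k FP.≟ i | k FP.≟ j
  ... | yes k≡i | _ = at-i k≡i
  ... | no k≢i | yes k≡j = at-j k≢i k≡j
  ... | no k≢i | no k≢j = away k≢i k≢j

  s-at-i : (i j : Fin n) → s i j ∙ i ≡ j
  s-at-i i j rewrite dec-true (i FP.≟ i) refl = refl

  s-at-j : (i j : Fin n) → s i j ∙ j ≡ i
  s-at-j i j with j FP.≟ i
  ... | yes j≡i = j≡i
  ... | no _ rewrite dec-true (j FP.≟ j) refl = refl

  s-away : (i j k : Fin n) → k ≢ i → k ≢ j → s i j ∙ k ≡ k
  s-away i j k k≢i k≢j rewrite dec-false (k FP.≟ i) k≢i | dec-false (k FP.≟ j) k≢j = refl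

  s-comm : (i j k : Fin n) → s i j ∙ k ≡ s j i ∙ k
  s-comm i j k with transposeView i j k
  ... | at-i refl = trans (s-at-i k j) (sym (s-at-j j k))
  ... | at-j _ refl = trans (s-at-j i k) (sym (s-at-i k i))
  ... | away k≢i k≢j = trans (s-away i j k k≢i k≢j) (sym (s-away j i k k≢j k≢i))

  s-involutive : (i j k : Fin n) → s i j ∙ (s i j ∙ k) ≡ k
  s-involutive i j k = trans (cong (s i j ∙_) (s-comm i j k)) (PC.transpose-inverse i j)

  s-conjugate : (σ : Permutation′ n) (i j x : Fin n) →
                s i j ∙ σ ∙ x ≡ σ ∙ s ((σ ⁻¹) ∙ i) ((σ ⁻¹) ∙ j) ∙ x
  s-conjugate σ i j x with transposeView ((σ ⁻¹) ∙ i) ((σ ⁻¹) ∙ j) x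
  ... | at-i refl
    rewrite s-at-i ((σ ⁻¹) ∙ i) ((σ ⁻¹) ∙ j) | Perm.inverseʳ σ {i} | Perm.inverseʳ σ {j} = s-at-i i j
  ... | at-j _ refl
    rewrite s-at-j ((σ ⁻¹) ∙ i) ((σ ⁻¹) ∙ j) | Perm.inverseʳ σ {i} | Perm.inverseʳ σ {j} = s-at-j i j
  ... | away x≢i x≢j rewrite s-away _ _ x x≢i x≢j =
    s-away i j (σ ∙ x) (x≢i ∘ ∙≡⇒≡⁻¹∙ σ) (x≢j ∘ ∙≡⇒≡⁻¹∙ σ)

  Inversion : Permutation′ n → Fin n → Fin n → Set
  Inversion u i j = i F.< j × u ∙ j F.< u ∙ i

  inversion? : (u : Permutation′ n) (i j : Fin n) → Dec (Inversion u i j)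
  inversion? u i j = (i <? j) ×-dec (u ∙ j <? u ∙ i)

  inversions : Permutation′ n → Fin n → Fin n → ℕ
  inversions u i j = indicator (inversion? u i j)

  len≡∑∑inversions : (u : Permutation′ n) → len u ≡ ∑∑ (inversions u)
  len≡∑∑inversions u =
    trans (length-filter-concatMap P? (λ i → map (i ,_) (allFin n)) (λ i → i))
          (sum-cong-≗ λ i → trans (cong (length ∘ filter P?) (LP.map-tabulate (λ j → j) (i ,_)))
                                  (length-filter-tabulate P? (i ,_)))
    where P? = λ ((i , j) : Fin n × Fin n) → inversion? u i j

  len-cong : {u v : Permutation′ n} → u ≈ v → len u ≡ len v
  len-cong {u} {v} u≈v = begin
    len u                ≡⟨ len≡∑∑inversions u ⟩
    ∑∑ (inversions u)    ≡⟨ ∑∑-cong same ⟩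
    ∑∑ (inversions v)    ≡⟨ len≡∑∑inversions v ⟨
    len v                ∎
    where
    open ≡-Reasoning
    transport : ∀ {w w'} → w ≈ w' → ∀ {i j} → Inversion w i j → Inversion w' i j
    transport w≈w' (i<j , inv) = i<j , subst₂ F._<_ (w≈w' _) (w≈w' _) inv
    same : ∀ i j → inversions u i j ≡ inversions v i j
    same i j = indicator-cong (transport {u} {v} u≈v) (transport {v} {u} (sym ∘ u≈v))
                              (inversion? u i j) (inversion? v i j)

  len-⁻¹ : (u : Permutation′ n) → len (u ⁻¹) ≡ len u
  len-⁻¹ u = begin
    len (u ⁻¹)                                         ≡⟨ len≡∑∑inversions (u ⁻¹) ⟩
    ∑∑ (inversions (u ⁻¹))                             ≡⟨ ∑∑-permute u _ ⟩
    ∑∑ (λ i j → inversions (u ⁻¹) (u ∙ i) (u ∙ j))     ≡⟨ ∑∑-cong swapped ⟩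
    ∑∑ (λ i j → inversions u j i)                      ≡⟨ ∑-comm (inversions u) ⟨
    ∑∑ (inversions u)                                  ≡⟨ len≡∑∑inversions u ⟨
    len u                                              ∎
    where
    open ≡-Reasoning
    swap : ∀ {i j} → Inversion (u ⁻¹) (u ∙ i) (u ∙ j) → Inversion u j i
    swap (ui<uj , ji) = subst₂ F._<_ (Perm.inverseˡ u) (Perm.inverseˡ u) ji , ui<uj
    swap⁻ : ∀ {i j} → Inversion u j i → Inversion (u ⁻¹) (u ∙ i) (u ∙ j)
    swap⁻ (j<i , ui<uj) = ui<uj , subst₂ F._<_ (sym (Perm.inverseˡ u)) (sym (Perm.inverseˡ u)) j<i
    swapped : ∀ i j → inversions (u ⁻¹) (u ∙ i) (u ∙ j) ≡ inversions u j i
    swapped i j = indicator-cong swap swap⁻ (inversion? (u ⁻¹) (u ∙ i) (u ∙ j)) (inversion? u j i)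

  len-id : len (id {n}) ≡ 0
  len-id = begin
    len (id {n})                     ≡⟨ len≡∑∑inversions id ⟩
    ∑∑ (inversions id)               ≡⟨ ∑∑-cong {n} (λ i j → indicator-no (uncurry ℕP.<-asym) _) ⟩
    sum {n} (λ _ → sum {n} (λ _ → 0)) ≡⟨ sum-cong-≗ {n} (λ _ → sum-replicate-zero n) ⟩
    sum {n} (λ _ → 0)                ≡⟨ sum-replicate-zero n ⟩
    0                                ∎
    where open ≡-Reasoning

len-·s : ∀ {n} (u : Permutation′ n) (i j : Fin n) → len (u · s i j) ≡ len (s i j · (u ⁻¹))
len-·s u i j = trans (sym (len-⁻¹ (u · s i j)))
  (len-cong {u = (u · s i j) ⁻¹} {v = s i j · (u ⁻¹)} (λ x → s-comm j i ((u ⁻¹) ∙ x)))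

-- Multiplication by an adjacent transposition sₐ = s a (a + 1)

module Adjacent {n : ℕ} (a a' : Fin n) (a'≡1+a : toℕ a' ≡ suc (toℕ a)) where

  sₐ : Permutation′ n
  sₐ = s a a'

  a<a' : a F.< a'
  a<a' = subst (toℕ a ℕ.<_) (sym a'≡1+a) (ℕP.n<1+n (toℕ a))

  a≢a' : a ≢ a'
  a≢a' a≡a' = ℕP.<-irrefl (cong toℕ a≡a') a<a'

  a<x⇒a'<x : ∀ {x} → a F.< x → x ≢ a' → a' F.< x
  a<x⇒a'<x {x} a<x x≢a' =
    ℕP.≤∧≢⇒< (subst (ℕ._≤ toℕ x) (sym a'≡1+a) a<x) (x≢a' ∘ FP.toℕ-injective ∘ sym)

  x<a'⇒x<a : ∀ {x} → x F.< a' → x ≢ a → x F.< a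
  x<a'⇒x<a {x} x<a' x≢a =
    ℕP.≤∧≢⇒< (ℕP.≤-pred (subst (toℕ x ℕ.<_) a'≡1+a x<a')) (x≢a ∘ FP.toℕ-injective)

  sₐ-preserves-< : ∀ {x y} → x F.< y → ¬ (x ≡ a × y ≡ a') → sₐ ∙ x F.< sₐ ∙ y
  sₐ-preserves-< {x} {y} x<y ¬aa' with transposeView a a' x | transposeView a a' y
  ... | at-i refl   | at-i refl   = ⊥-elim (ℕP.<-irrefl refl x<y)
  ... | at-i refl   | at-j _ refl = ⊥-elim (¬aa' (refl , refl))
  ... | at-i refl   | away y≢a y≢a' rewrite s-at-i a a' | s-away a a' y y≢a y≢a' = a<x⇒a'<x x<y y≢a'
  ... | at-j _ refl | at-i refl   = ⊥-elim (ℕP.<-asym x<y a<a')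
  ... | at-j _ refl | at-j _ refl = ⊥-elim (ℕP.<-irrefl refl x<y)
  ... | at-j _ refl | away y≢a y≢a' rewrite s-at-j a a' | s-away a a' y y≢a y≢a' = ℕP.<-trans a<a' x<y
  ... | away x≢a x≢a' | at-i refl rewrite s-at-i a a' | s-away a a' x x≢a x≢a' = ℕP.<-trans x<y a<a'
  ... | away x≢a x≢a' | at-j _ refl rewrite s-at-j a a' | s-away a a' x x≢a x≢a' = x<a'⇒x<a x<y x≢a
  ... | away x≢a x≢a' | away y≢a y≢a'
    rewrite s-away a a' x x≢a x≢a' | s-away a a' y y≢a y≢a' = x<y

  -- Descent u: a is a left descent of u, that is ℓ(sₐ u) < ℓ(u).
  Descent Ascent : Permutation′ n → Set
  Descent u = (u ⁻¹) ∙ a' F.< (u ⁻¹) ∙ a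
  Ascent u = (u ⁻¹) ∙ a F.< (u ⁻¹) ∙ a'

  descent? : (u : Permutation′ n) → Dec (Descent u)
  descent? u = (u ⁻¹) ∙ a' <? (u ⁻¹) ∙ a

  ascent⇒¬descent : ∀ {u} → Ascent u → ¬ Descent u
  ascent⇒¬descent = ℕP.<-asym

  ¬descent⇒ascent : ∀ u → ¬ Descent u → Ascent u
  ¬descent⇒ascent u ¬desc with FP.<-cmp ((u ⁻¹) ∙ a) ((u ⁻¹) ∙ a')
  ... | tri< asc _ _ = asc
  ... | tri≈ _ eq _  = ⊥-elim (a≢a' (∙-injective (u ⁻¹) eq))
  ... | tri> _ _ desc = ⊥-elim (¬desc desc)

  descent⇒ascent-sₐ· : ∀ u → Descent u → Ascent (sₐ · u)
  descent⇒ascent-sₐ· u =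
    subst₂ F._<_ (cong ((u ⁻¹) ∙_) (sym (s-at-j a' a))) (cong ((u ⁻¹) ∙_) (sym (s-at-i a' a)))

  ascent⇒descent-sₐ· : ∀ u → Ascent u → Descent (sₐ · u)
  ascent⇒descent-sₐ· u =
    subst₂ F._<_ (cong ((u ⁻¹) ∙_) (sym (s-at-i a' a))) (cong ((u ⁻¹) ∙_) (sym (s-at-j a' a)))

  Descent-cong : ∀ {u v} → u ≈ v → Descent u → Descent v
  Descent-cong {u} {v} u≈v =
    subst₂ F._<_ (⁻¹-cong {u = u} {v = v} u≈v a') (⁻¹-cong {u = u} {v = v} u≈v a)

  sₐ·sₐ· : ∀ u → sₐ · (sₐ · u) ≈ u
  sₐ·sₐ· u x = s-involutive a a' (u ∙ x)

  len-sₐ·-ascent : ∀ u → Ascent u → suc (len u) ≡ len (sₐ · u)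
  len-sₐ·-ascent u asc = begin
    suc (len u)                              ≡⟨ cong suc (len≡∑∑inversions u) ⟩
    suc (∑∑ (inversions u))                  ≡⟨ ℕP.+-comm 1 _ ⟩
    ∑∑ (inversions u) + 1                    ≡⟨ cong (∑∑ (inversions u) +_) new ⟨
    ∑∑ (inversions u) + inversions (sₐ · u) p q ≡⟨ ∑∑-update (inversions (sₐ · u)) (inversions u) p q same ⟨
    ∑∑ (inversions (sₐ · u)) + inversions u p q ≡⟨ cong (∑∑ (inversions (sₐ · u)) +_) old ⟩
    ∑∑ (inversions (sₐ · u)) + 0             ≡⟨ ℕP.+-identityʳ _ ⟩
    ∑∑ (inversions (sₐ · u))                 ≡⟨ len≡∑∑inversions (sₐ · u) ⟨
    len (sₐ · u)                             ∎
    where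
    open ≡-Reasoning
    p = (u ⁻¹) ∙ a
    q = (u ⁻¹) ∙ a'
    up : u ∙ p ≡ a
    up = Perm.inverseʳ u
    uq : u ∙ q ≡ a'
    uq = Perm.inverseʳ u
    forward : ∀ {i j} → Inversion u i j → Inversion (sₐ · u) i j
    forward {i} {j} (i<j , uj<ui) = i<j , sₐ-preserves-< uj<ui
      λ (uj≡a , ui≡a') → ℕP.<-asym asc (subst₂ F._<_ (∙≡⇒≡⁻¹∙ u ui≡a') (∙≡⇒≡⁻¹∙ u uj≡a) i<j)
    backward : ∀ {i j} → ¬ (i ≡ p × j ≡ q) → Inversion (sₐ · u) i j → Inversion u i j
    backward {i} {j} ≢pq (i<j , inv) = i<j , subst₂ F._<_ (s-involutive a a' _) (s-involutive a a' _)
      (sₐ-preserves-< inv λ (suj≡a , sui≡a') →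
        ≢pq ( ∙≡⇒≡⁻¹∙ u (∙-injective sₐ (trans sui≡a' (sym (s-at-i a a'))))
            , ∙≡⇒≡⁻¹∙ u (∙-injective sₐ (trans suj≡a (sym (s-at-j a a'))))))
    same : ∀ i j → ¬ (i ≡ p × j ≡ q) → inversions (sₐ · u) i j ≡ inversions u i j
    same i j ≢pq = indicator-cong (backward ≢pq) forward (inversion? (sₐ · u) i j) (inversion? u i j)
    new : inversions (sₐ · u) p q ≡ 1
    new = indicator-yes (asc , subst₂ F._<_ (sym (trans (cong (sₐ ∙_) uq) (s-at-j a a')))
                                             (sym (trans (cong (sₐ ∙_) up) (s-at-i a a'))) a<a')
                        (inversion? (sₐ · u) p q)
    old : inversions u p q ≡ 0
    old = indicator-no (λ (_ , uq<up) → ℕP.<-asym a<a' (subst₂ F._<_ uq up uq<up)) (inversion? u p q)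

  len-sₐ·-descent : ∀ u → Descent u → suc (len (sₐ · u)) ≡ len u
  len-sₐ·-descent u desc =
    trans (len-sₐ·-ascent (sₐ · u) (descent⇒ascent-sₐ· u desc))
          (len-cong {u = sₐ · (sₐ · u)} {v = u} (sₐ·sₐ· u))

  len-sₐ·-≤ : ∀ u → len (sₐ · u) ≤ suc (len u)
  len-sₐ·-≤ u with descent? u
  ... | yes desc = ℕP.m≤n⇒m≤1+n (ℕP.<⇒≤ (ℕP.≤-reflexive (len-sₐ·-descent u desc)))
  ... | no ¬desc = ℕP.≤-reflexive (sym (len-sₐ·-ascent u (¬descent⇒ascent u ¬desc)))

  len-·sₐ-ascent : ∀ u → u ∙ a F.< u ∙ a' → suc (len u) ≡ len (u · sₐ)
  len-·sₐ-ascent u asc =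
    trans (cong suc (sym (len-⁻¹ u))) (trans (len-sₐ·-ascent (u ⁻¹) asc) (sym (len-·s u a a')))

  len-·sₐ-descent : ∀ u → u ∙ a' F.< u ∙ a → suc (len (u · sₐ)) ≡ len u
  len-·sₐ-descent u desc =
    trans (cong suc (len-·s u a a')) (trans (len-sₐ·-descent (u ⁻¹) desc) (len-⁻¹ u))

  len-·sₐ-≤ : ∀ u → len (u · sₐ) ≤ suc (len u)
  len-·sₐ-≤ u = subst₂ _≤_ (sym (len-·s u a a')) (cong suc (len-⁻¹ u)) (len-sₐ·-≤ (u ⁻¹))

s-conjugate-s : ∀ {n} {i k j : Fin n} → i ≢ k → k ≢ j → i ≢ j →
                ∀ x → s i k ∙ s k j ∙ s i k ∙ x ≡ s i j ∙ x
s-conjugate-s {i = i} {k} {j} i≢k k≢j i≢j x = begin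
  s i k ∙ s k j ∙ s i k ∙ x                      ≡⟨ cong (s i k ∙_) (s-conjugate (s i k) k j x) ⟩
  s i k ∙ s i k ∙ s (s k i ∙ k) (s k i ∙ j) ∙ x  ≡⟨ s-involutive i k _ ⟩
  s (s k i ∙ k) (s k i ∙ j) ∙ x                  ≡⟨ cong₂ (λ p q → s p q ∙ x) (s-at-i k i) s-ki∙j ⟩
  s i j ∙ x                                      ∎
  where
  open ≡-Reasoning
  s-ki∙j = s-away k i j (k≢j ∘ sym) (i≢j ∘ sym)

module Factorisation {n : ℕ} (u : Permutation′ n) {i k j : Fin n} (i<k : i F.< k) (k<j : k F.< j) where

  i≢k = FP.<⇒≢ i<k
  k≢j = FP.<⇒≢ k<j
  i≢j = FP.<⇒≢ (FP.<-trans i<k k<j)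

  u₁ u₂ u₃ : Permutation′ n
  u₁ = u · s i k
  u₂ = u₁ · s k j
  u₃ = u₂ · s i k

  len-u₃ : len u₃ ≡ len (u · s i j)
  len-u₃ = len-cong {u = u₃} {v = u · s i j} (λ x → cong (u ∙_) (s-conjugate-s i≢k k≢j i≢j x))

  u₁∙k : u₁ ∙ k ≡ u ∙ i
  u₁∙k = cong (u ∙_) (s-at-j i k)

  u₁∙j : u₁ ∙ j ≡ u ∙ j
  u₁∙j = cong (u ∙_) (s-away i k j (i≢j ∘ sym) (k≢j ∘ sym))

  u₂∙i : u₂ ∙ i ≡ u ∙ k
  u₂∙i = trans (cong (u₁ ∙_) (s-away k j i i≢k i≢j)) (cong (u ∙_) (s-at-i i k))

  u₂∙k : u₂ ∙ k ≡ u ∙ j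
  u₂∙k = trans (cong (u₁ ∙_) (s-at-i k j)) u₁∙j

-- Induction on j − i through s i j = s i k · s k j · s i k with k = i + 1.
private
  len-·s-inversion-at : ∀ d {n} (u : Permutation′ n) (i j : Fin n) → toℕ j ≡ suc (d + toℕ i) →
                        u ∙ j F.< u ∙ i → suc (len (u · s i j)) ≤ len u
  len-·s-inversion-at zero u i j j≡1+i uj<ui = ℕP.≤-reflexive (Adjacent.len-·sₐ-descent i j j≡1+i u uj<ui)
  len-·s-inversion-at (suc d) {n} u i j j≡2+d+i uj<ui =
    subst (λ l → suc l ≤ len u) len-u₃ (bound (FP.<-cmp (u ∙ i) (u ∙ k)))
    where
    k = F.fromℕ< (ℕP.≤-<-trans (s≤s (ℕP.m≤n+m (toℕ i) (suc d))) (subst (ℕ._< n) j≡2+d+i (FP.toℕ<n j)))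
    k≡1+i : toℕ k ≡ suc (toℕ i)
    k≡1+i = FP.toℕ-fromℕ< _
    j≡1+d+k : toℕ j ≡ suc (d + toℕ k)
    j≡1+d+k = trans j≡2+d+i (cong suc (trans (sym (ℕP.+-suc d (toℕ i))) (cong (d +_) (sym k≡1+i))))
    i<k : i F.< k
    i<k = subst (toℕ i ℕ.<_) (sym k≡1+i) (ℕP.n<1+n (toℕ i))
    k<j : k F.< j
    k<j = subst (toℕ k ℕ.<_) (sym j≡1+d+k) (s≤s (ℕP.m≤n+m (toℕ k) d))
    open Factorisation u i<k k<j
    open Adjacent i k k≡1+i using (len-·sₐ-ascent; len-·sₐ-descent; len-·sₐ-≤)
    u₂<u₁ : suc (len u₂) ≤ len u₁
    u₂<u₁ = len-·s-inversion-at d u₁ k j j≡1+d+k (subst₂ F._<_ (sym u₁∙j) (sym u₁∙k) uj<ui)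
    bound : Tri (u ∙ i F.< u ∙ k) (u ∙ i ≡ u ∙ k) (u ∙ k F.< u ∙ i) → suc (len u₃) ≤ len u
    bound (tri< ui<uk _ _) = begin
      suc (len u₃) ≡⟨ len-·sₐ-descent u₂ (subst₂ F._<_ (sym u₂∙k) (sym u₂∙i) (FP.<-trans uj<ui ui<uk)) ⟩
      len u₂       ≤⟨ ℕP.≤-pred (ℕP.≤-trans u₂<u₁ (ℕP.≤-reflexive (sym (len-·sₐ-ascent u ui<uk)))) ⟩
      len u        ∎
      where open ℕP.≤-Reasoning
    bound (tri≈ _ ui≡uk _) = ⊥-elim (i≢k (∙-injective u ui≡uk))
    bound (tri> _ _ uk<ui) = begin
      suc (len u₃)       ≤⟨ s≤s (len-·sₐ-≤ u₂) ⟩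
      suc (suc (len u₂)) ≤⟨ s≤s u₂<u₁ ⟩
      suc (len u₁)       ≡⟨ len-·sₐ-descent u uk<ui ⟩
      len u              ∎
      where open ℕP.≤-Reasoning

len-·s-inversion : ∀ {n} (u : Permutation′ n) {i j : Fin n} → i F.< j → u ∙ j F.< u ∙ i →
                   suc (len (u · s i j)) ≤ len u
len-·s-inversion u {i} {j} i<j = len-·s-inversion-at (toℕ j ℕ.∸ suc (toℕ i)) u i j
  (sym (trans (sym (ℕP.+-suc (toℕ j ℕ.∸ suc (toℕ i)) (toℕ i))) (ℕP.m∸n+n≡m i<j)))

len-·s-3inversions : ∀ {n} (u : Permutation′ n) {i k j : Fin n} → i F.< k → k F.< j →
                     u ∙ j F.< u ∙ k → u ∙ k F.< u ∙ i → 3 + len (u · s i j) ≤ len u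
len-·s-3inversions u {i} {k} {j} i<k k<j uj<uk uk<ui = begin
  3 + len (u · s i j) ≡⟨ cong (3 +_) len-u₃ ⟨
  3 + len u₃          ≤⟨ s≤s (s≤s (len-·s-inversion u₂ i<k (subst₂ F._<_ (sym u₂∙k) (sym u₂∙i) uj<uk))) ⟩
  2 + len u₂          ≤⟨ s≤s (len-·s-inversion u₁ k<j (subst₂ F._<_ (sym u₁∙j) (sym u₁∙k) uj<ui)) ⟩
  1 + len u₁          ≤⟨ len-·s-inversion u i<k uk<ui ⟩
  len u               ∎
  where
  open ℕP.≤-Reasoning
  open Factorisation u i<k k<j
  uj<ui = FP.<-trans uj<uk uk<ui

-- Bruhat covers and the lifting property

⋖-cong : ∀ {n} {X X' Y Y' : Permutation′ n} → X ≈ X' → Y ≈ Y' → X ⋖ Y → X' ⋖ Y'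
⋖-cong {X = X} {X'} {Y} {Y'} X≈X' Y≈Y' (len-suc , i , j , i<j , X≈Ys) =
  trans (cong suc (sym (len-cong {u = X} {v = X'} X≈X'))) (trans len-suc (len-cong {u = Y} {v = Y'} Y≈Y')) ,
  i , j , i<j , λ x → trans (sym (X≈X' x)) (trans (X≈Ys x) (Y≈Y' _))

s·⋖ : ∀ {n} (Y : Permutation′ n) {i j : Fin n} → i ≢ j →
      suc (len (s i j · Y)) ≡ len Y → (s i j · Y) ⋖ Y
s·⋖ Y {i} {j} i≢j len-suc with FP.<-cmp ((Y ⁻¹) ∙ i) ((Y ⁻¹) ∙ j)
... | tri< lt _ _ = len-suc , _ , _ , lt , s-conjugate Y i j
... | tri≈ _ eq _ = ⊥-elim (i≢j (∙-injective (Y ⁻¹) eq))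
... | tri> _ _ gt = len-suc , _ , _ , gt , λ x → trans (s-conjugate Y i j x) (cong (Y ∙_) (s-comm _ _ x))

module Lifting {n : ℕ} (a a' : Fin n) (a'≡1+a : toℕ a' ≡ suc (toℕ a)) where
  open Adjacent a a' a'≡1+a

  sₐ·⋖ : ∀ {Y} → Descent Y → (sₐ · Y) ⋖ Y
  sₐ·⋖ {Y} desc = s·⋖ Y a≢a' (len-sₐ·-descent Y desc)

  sₐ·-⋖ : ∀ {X Y} → Descent X → Descent Y → X ⋖ Y → (sₐ · X) ⋖ (sₐ · Y)
  sₐ·-⋖ {X} {Y} descX descY (len-suc , i , j , i<j , X≈Ys) =
    ℕP.suc-injective (trans (cong suc (len-sₐ·-descent X descX))
                            (trans len-suc (sym (len-sₐ·-descent Y descY)))) ,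
    i , j , i<j , λ x → cong (sₐ ∙_) (X≈Ys x)

  sₐ·-⋖⁻ : ∀ {X Y} → Descent X → Descent Y → (sₐ · X) ⋖ (sₐ · Y) → X ⋖ Y
  sₐ·-⋖⁻ {X} {Y} descX descY (len-suc , i , j , i<j , X≈Ys) =
    trans (cong suc (sym (len-sₐ·-descent X descX))) (trans (cong suc len-suc) (len-sₐ·-descent Y descY)) ,
    i , j , i<j , λ x → trans (sym (s-involutive a a' _))
                              (trans (cong (sₐ ∙_) (X≈Ys x)) (s-involutive a a' _))

  -- With X = Y · s i j, place Y⁻¹ a and Y⁻¹ a' among i, j: every configuration but the swap
  -- contradicts one of the hypotheses or would let a single cover remove three inversions.
  lifting : ∀ {X Y} → X ⋖ Y → ¬ Descent X → Descent Y → X ≈ sₐ · Y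
  lifting {X} {Y} (len-suc , i , j , i<j , X≈Yt) ¬descX descY =
    go (transposeView i j p) (transposeView i j q)
    where
    p = (Y ⁻¹) ∙ a
    q = (Y ⁻¹) ∙ a'
    Yp : Y ∙ p ≡ a
    Yp = Perm.inverseʳ Y
    Yq : Y ∙ q ≡ a'
    Yq = Perm.inverseʳ Y
    t = s i j
    tp<tq : t ∙ p F.< t ∙ q
    tp<tq = subst₂ F._<_ (trans (⁻¹-cong {u = X} {v = Y · t} X≈Yt a) (s-comm j i p))
                         (trans (⁻¹-cong {u = X} {v = Y · t} X≈Yt a') (s-comm j i q))
                         (¬descent⇒ascent X ¬descX)
    len-X : len X ≡ len (Y · t)
    len-X = len-cong {u = X} {v = Y · t} X≈Yt
    X·t≈Y : X · t ≈ Y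
    X·t≈Y x = trans (X≈Yt _) (cong (Y ∙_) (s-involutive i j x))
    Yj<Yi : Y ∙ j F.< Y ∙ i
    Yj<Yi with FP.<-cmp (Y ∙ j) (Y ∙ i)
    ... | tri< lt _ _ = lt
    ... | tri≈ _ eq _ = ⊥-elim (FP.<⇒≢ i<j (sym (∙-injective Y eq)))
    ... | tri> _ _ gt = ⊥-elim (ℕP.<-asym (ℕP.≤-reflexive len-suc)
      (subst (λ l → suc l ≤ len X) (len-cong {u = X · t} {v = Y} X·t≈Y)
        (len-·s-inversion X i<j (subst₂ F._<_ (sym (trans (X≈Yt j) (cong (Y ∙_) (s-at-j i j))))
                                              (sym (trans (X≈Yt i) (cong (Y ∙_) (s-at-i i j)))) gt))))
    no-3-pattern : ∀ {k} → i F.< k → k F.< j → Y ∙ j F.< Y ∙ k → Y ∙ k F.< Y ∙ i → ⊥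
    no-3-pattern i<k k<j Yj<Yk Yk<Yi = ℕP.m+n≮n 1 (len X) (ℕP.≤-pred
      (subst₂ _≤_ (cong (3 +_) (sym len-X)) (sym len-suc) (len-·s-3inversions Y i<k k<j Yj<Yk Yk<Yi)))
    p≢q : p ≢ q
    p≢q = a≢a' ∘ ∙-injective (Y ⁻¹)
    swapped : p ≡ j → q ≡ i → X ≈ sₐ · Y
    swapped p≡j q≡i x with transposeView i j x
    ... | at-i refl = begin
      X ∙ x           ≡⟨ X≈Yt x ⟩
      Y ∙ t ∙ x       ≡⟨ cong (Y ∙_) (trans (s-at-i x j) (sym p≡j)) ⟩
      Y ∙ p           ≡⟨ Yp ⟩
      a               ≡⟨ s-at-j a a' ⟨
      sₐ ∙ a'         ≡⟨ cong (sₐ ∙_) (trans (cong (Y ∙_) (sym q≡i)) Yq) ⟨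
      sₐ ∙ Y ∙ x      ∎
      where open ≡-Reasoning
    ... | at-j _ refl = begin
      X ∙ x           ≡⟨ X≈Yt x ⟩
      Y ∙ t ∙ x       ≡⟨ cong (Y ∙_) (trans (s-at-j i x) (sym q≡i)) ⟩
      Y ∙ q           ≡⟨ Yq ⟩
      a'              ≡⟨ s-at-i a a' ⟨
      sₐ ∙ a          ≡⟨ cong (sₐ ∙_) (trans (cong (Y ∙_) (sym p≡j)) Yp) ⟨
      sₐ ∙ Y ∙ x      ∎
      where open ≡-Reasoning
    ... | away x≢i x≢j = trans (X≈Yt x) (trans (cong (Y ∙_) (s-away i j x x≢i x≢j))
      (sym (s-away a a' (Y ∙ x) (λ Yx≡a → x≢j (trans (∙≡⇒≡⁻¹∙ Y Yx≡a) p≡j))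
                                (λ Yx≡a' → x≢i (trans (∙≡⇒≡⁻¹∙ Y Yx≡a') q≡i)))))
    go : TransposeView i j p → TransposeView i j q → X ≈ sₐ · Y
    go (at-i p≡i) (at-i q≡i) = ⊥-elim (p≢q (trans p≡i (sym q≡i)))
    go (at-i p≡i) (at-j _ q≡j) = ⊥-elim (FP.<-asym descY (subst₂ F._<_ (sym p≡i) (sym q≡j) i<j))
    go (at-i p≡i) (away q≢i q≢j) = ⊥-elim (FP.<-asym
      (subst₂ F._<_ (trans (cong (t ∙_) p≡i) (s-at-i i j)) (s-away i j q q≢i q≢j) tp<tq)
      (FP.<-trans (subst (q F.<_) p≡i descY) i<j))
    go (at-j _ p≡j) (at-i q≡i) = swapped p≡j q≡i
    go (at-j _ p≡j) (at-j _ q≡j) = ⊥-elim (p≢q (trans p≡j (sym q≡j)))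
    go (at-j _ p≡j) (away q≢i q≢j) = ⊥-elim (no-3-pattern
      (subst₂ F._<_ (trans (cong (t ∙_) p≡j) (s-at-j i j)) (s-away i j q q≢i q≢j) tp<tq)
      (subst (q F.<_) p≡j descY)
      (subst₂ F._<_ (trans (sym Yp) (cong (Y ∙_) p≡j)) (sym Yq) a<a')
      (subst (F._< Y ∙ i) (sym Yq)
        (a<x⇒a'<x (subst (F._< Y ∙ i) (trans (cong (Y ∙_) (sym p≡j)) Yp) Yj<Yi) (q≢i ∘ sym ∘ ∙≡⇒≡⁻¹∙ Y))))
    go (away p≢i p≢j) (at-i q≡i) = ⊥-elim (no-3-pattern
      (subst (F._< p) q≡i descY)
      (subst₂ F._<_ (s-away i j p p≢i p≢j) (trans (cong (t ∙_) q≡i) (s-at-i i j)) tp<tq)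
      (subst (Y ∙ j F.<_) (sym Yp)
        (x<a'⇒x<a (subst (Y ∙ j F.<_) (trans (cong (Y ∙_) (sym q≡i)) Yq) Yj<Yi) (p≢j ∘ sym ∘ ∙≡⇒≡⁻¹∙ Y)))
      (subst₂ F._<_ (sym Yp) (trans (sym Yq) (cong (Y ∙_) q≡i)) a<a'))
    go (away p≢i p≢j) (at-j _ q≡j) = ⊥-elim (FP.<-asym
      (subst₂ F._<_ (s-away i j p p≢i p≢j) (trans (cong (t ∙_) q≡j) (s-at-j i j)) tp<tq)
      (FP.<-trans i<j (subst (F._< p) q≡j descY)))
    go (away p≢i p≢j) (away q≢i q≢j) =
      ⊥-elim (FP.<-asym descY (subst₂ F._<_ (s-away i j p p≢i p≢j) (s-away i j q q≢i q≢j) tp<tq))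

-- Signs and the pairing

sign : ∀ {n} → Gen n → ℤ
sign (i , j) with j <? i
... | yes _ = - 1ℤ
... | no _ = 1ℤ

wordSign : ∀ {n} → Mono n → ℤ
wordSign [] = 1ℤ
wordSign (g ∷ m) = sign g ℤ.* wordSign m

sign-< : ∀ {n} {i j : Fin n} → i F.< j → sign (i , j) ≡ 1ℤ
sign-< {i = i} {j} i<j with j <? i
... | yes j<i = ⊥-elim (FP.<-asym i<j j<i)
... | no _ = refl

sign-> : ∀ {n} {i j : Fin n} → j F.< i → sign (i , j) ≡ - 1ℤ
sign-> {i = i} {j} j<i with j <? i
... | yes _ = refl
... | no j≮i = ⊥-elim (j≮i j<i)

sign-cong : ∀ {n} {i j k l : Fin n} → (j F.< i → l F.< k) → (l F.< k → j F.< i) → sign (i , j) ≡ sign (k , l)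
sign-cong {i = i} {j} {k} {l} f g with j <? i | l <? k
... | yes _ | yes _ = refl
... | yes j<i | no l≮k = ⊥-elim (l≮k (f j<i))
... | no j≮i | yes l<k = ⊥-elim (j≮i (g l<k))
... | no _ | no _ = refl

wordSign-increasing : ∀ {n} (P : Mono n) → IncreasingPairs P → wordSign P ≡ 1ℤ
wordSign-increasing [] _ = refl
wordSign-increasing (_ ∷ P) (i<j ∷ inc) rewrite sign-< i<j | wordSign-increasing P inc = refl

eqF-true : ∀ {n} {i j : Fin n} → i ≡ j → eqF i j ≡ true
eqF-true {i = i} {j} i≡j = trans (isYes≗does (i FP.≟ j)) (dec-true (i FP.≟ j) i≡j)

eqF-false : ∀ {n} {i j : Fin n} → i ≢ j → eqF i j ≡ false
eqF-false {i = i} {j} i≢j = trans (isYes≗does (i FP.≟ j)) (dec-false (i FP.≟ j) i≢j)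

eqF-∧-false : ∀ {n} {i j k l : Fin n} → ¬ (i ≡ k × j ≡ l) → eqF i k ∧ eqF j l ≡ false
eqF-∧-false {i = i} {j} {k} {l} ≢ with i FP.≟ k
... | no i≢k = refl
... | yes i≡k = eqF-false (λ j≡l → ≢ (i≡k , j≡l))

module Pairing {n : ℕ} where

  ⟨_,_⟩ₗ : Mono n → Lin n → ℤ
  ⟨ W , L ⟩ₗ = scalar (ΔP W L)

  scale : ℤ → Lin n → Lin n
  scale c = map (λ (c' , m) → (c ℤ.* c' , m))

  scalar-++ : ∀ (L₁ L₂ : Lin n) → scalar (L₁ ++ L₂) ≡ scalar L₁ ℤ.+ scalar L₂
  scalar-++ [] L₂ = sym (ℤP.+-identityˡ _)
  scalar-++ ((c , []) ∷ L₁) L₂ = trans (cong (λ z → c ℤ.+ z) (scalar-++ L₁ L₂)) (sym (ℤP.+-assoc c _ _))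
  scalar-++ ((c , _ ∷ _) ∷ L₁) L₂ = scalar-++ L₁ L₂

  scalar-scale : ∀ c (L : Lin n) → scalar (scale c L) ≡ c ℤ.* scalar L
  scalar-scale c [] = sym (ℤP.*-zeroʳ c)
  scalar-scale c ((c' , []) ∷ L) =
    trans (cong (λ z → c ℤ.* c' ℤ.+ z) (scalar-scale c L)) (sym (ℤP.*-distribˡ-+ c c' _))
  scalar-scale c ((c' , _ ∷ _) ∷ L) = scalar-scale c L

  ΔP-[] : ∀ (W : Mono n) → ΔP W [] ≡ []
  ΔP-[] [] = refl
  ΔP-[] ((a , b) ∷ W) = cong (Δ a b) (ΔP-[] W)

  ΔP-++ : ∀ (W : Mono n) (L₁ L₂ : Lin n) → ΔP W (L₁ ++ L₂) ≡ ΔP W L₁ ++ ΔP W L₂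
  ΔP-++ [] L₁ L₂ = refl
  ΔP-++ ((a , b) ∷ W) L₁ L₂ = trans (cong (Δ a b) (ΔP-++ W L₁ L₂)) (LP.concatMap-++ _ (ΔP W L₁) (ΔP W L₂))

  Δ-scale : ∀ a b c (L : Lin n) → Δ a b (scale c L) ≡ scale c (Δ a b L)
  Δ-scale a b c [] = refl
  Δ-scale a b c ((c' , m) ∷ L) = begin
    map _ (Δmono a b m) ++ Δ a b (scale c L)
      ≡⟨ cong₂ _++_ (trans (LP.map-cong (λ (c'' , m') → cong (_, m') (ℤP.*-assoc c c' c'')) (Δmono a b m))
                           (LP.map-∘ (Δmono a b m)))
                    (Δ-scale a b c L) ⟩
    scale c (map _ (Δmono a b m)) ++ scale c (Δ a b L)
      ≡⟨ LP.map-++ _ (map _ (Δmono a b m)) (Δ a b L) ⟨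
    scale c (map _ (Δmono a b m) ++ Δ a b L) ∎
    where open ≡-Reasoning

  ΔP-scale : ∀ W c (L : Lin n) → ΔP W (scale c L) ≡ scale c (ΔP W L)
  ΔP-scale [] c L = refl
  ΔP-scale ((a , b) ∷ W) c L = trans (cong (Δ a b) (ΔP-scale W c L)) (Δ-scale a b c (ΔP W L))

  ⟨⟩ₗ-[] : ∀ W → ⟨ W , [] ⟩ₗ ≡ 0ℤ
  ⟨⟩ₗ-[] W = cong scalar (ΔP-[] W)

  ⟨⟩ₗ-++ : ∀ W (L₁ L₂ : Lin n) → ⟨ W , L₁ ++ L₂ ⟩ₗ ≡ ⟨ W , L₁ ⟩ₗ ℤ.+ ⟨ W , L₂ ⟩ₗ
  ⟨⟩ₗ-++ W L₁ L₂ = trans (cong scalar (ΔP-++ W L₁ L₂)) (scalar-++ (ΔP W L₁) (ΔP W L₂))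

  ⟨⟩ₗ-scale : ∀ W c (L : Lin n) → ⟨ W , scale c L ⟩ₗ ≡ c ℤ.* ⟨ W , L ⟩ₗ
  ⟨⟩ₗ-scale W c L = trans (cong scalar (ΔP-scale W c L)) (scalar-scale c (ΔP W L))

  ⟨⟩ₗ-∷ : ∀ W c (m : Mono n) (L : Lin n) → ⟨ W , (c , m) ∷ L ⟩ₗ ≡ c ℤ.* ⟨ W , m ⟩ ℤ.+ ⟨ W , L ⟩ₗ
  ⟨⟩ₗ-∷ W c m L = trans (⟨⟩ₗ-++ W ((c , m) ∷ []) L) (cong (ℤ._+ ⟨ W , L ⟩ₗ)
    (trans (cong (λ c' → ⟨ W , (c' , m) ∷ [] ⟩ₗ) (sym (ℤP.*-identityʳ c))) (⟨⟩ₗ-scale W c ((1ℤ , m) ∷ []))))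

  -- The linear extension of V evaluated at Δ a b (m), unfolded by the twisted Leibniz rule.
  evalΔ : Fin n → Fin n → (Mono n → ℤ) → Mono n → ℤ
  evalΔ a b V [] = 0ℤ
  evalΔ a b V (g ∷ m) = δ a b g ℤ.* V m ℤ.+ evalΔ a b (V ∘ (actGen (s a b) g ∷_)) m

  ⟨⟩ₗ-Δmono : ∀ a b W (f : Mono n → Mono n) m →
              ⟨ W , map (λ (c , m') → (c , f m')) (Δmono a b m) ⟩ₗ ≡ evalΔ a b (λ x → ⟨ W , f x ⟩) m
  ⟨⟩ₗ-Δmono a b W f [] = ⟨⟩ₗ-[] W
  ⟨⟩ₗ-Δmono a b W f (g ∷ m) = trans (⟨⟩ₗ-∷ W (δ a b g) (f m) _) (cong (λ z → δ a b g ℤ.* ⟨ W , f m ⟩ ℤ.+ z)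
    (trans (cong ⟨ W ,_⟩ₗ (sym (LP.map-∘ (Δmono a b m))))
           (⟨⟩ₗ-Δmono a b W (f ∘ (actGen (s a b) g ∷_)) m)))

  ⟨⟩-∷ʳ : ∀ a b W (P : Mono n) → ⟨ W ∷ʳ (a , b) , P ⟩ ≡ evalΔ a b ⟨ W ,_⟩ P
  ⟨⟩-∷ʳ a b W P = begin
    ⟨ W ∷ʳ (a , b) , P ⟩                 ≡⟨ cong scalar (ΔP-∷ʳ W) ⟩
    ⟨ W , Δ a b ((1ℤ , P) ∷ []) ⟩ₗ       ≡⟨ cong ⟨ W ,_⟩ₗ (trans (LP.++-identityʳ _) unit) ⟩
    ⟨ W , map (λ (c , m) → (c , m)) (Δmono a b P) ⟩ₗ ≡⟨ ⟨⟩ₗ-Δmono a b W (λ x → x) P ⟩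
    evalΔ a b ⟨ W ,_⟩ P                  ∎
    where
    open ≡-Reasoning
    unit = LP.map-cong (λ (c , m) → cong (_, m) (ℤP.*-identityˡ c)) (Δmono a b P)
    ΔP-∷ʳ : ∀ W → ΔP (W ∷ʳ (a , b)) ((1ℤ , P) ∷ []) ≡ ΔP W (Δ a b ((1ℤ , P) ∷ []))
    ΔP-∷ʳ [] = refl
    ΔP-∷ʳ ((a' , b') ∷ W) = cong (Δ a' b') (ΔP-∷ʳ W)

-- Saturated chains and the functionals that weigh them

s[_] : ∀ {n} → Gen n → Permutation′ n
s[ i , j ] = s i j

IsChain : ∀ {n} → Permutation′ n → Mono n → Set
IsChain T m = Covers m × (prodT m ≈ T)

ChainWeight : ∀ {n} → ℤ → Permutation′ n → Mono n → ℤ → Set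
ChainWeight c T m y = (IsChain T m → y ≡ c ℤ.* wordSign m) × (¬ IsChain T m → y ≡ 0ℤ)

module _ {n : ℕ} where

  IsChain-cong : ∀ {T T' : Permutation′ n} {m} → T ≈ T' → IsChain T m → IsChain T' m
  IsChain-cong T≈T' (covers , m≈T) = covers , λ x → trans (m≈T x) (T≈T' x)

  ChainWeight-cong : ∀ {c} {T T' : Permutation′ n} {m y} → T ≈ T' → ChainWeight c T m y → ChainWeight c T' m y
  ChainWeight-cong {T = T} {T'} T≈T' (chain , ¬chain) =
    (λ ch → chain (IsChain-cong {T = T'} {T} (sym ∘ T≈T') ch)) ,
    (λ ¬ch → ¬chain (¬ch ∘ IsChain-cong {T = T} {T'} T≈T'))

  IsChain-∷⁻ : ∀ (T : Permutation′ n) g m → IsChain T (g ∷ m) → ((s[ g ] · T) ⋖ T) × IsChain (s[ g ] · T) m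
  IsChain-∷⁻ T (i , j) m ((cover , covers) , gm≈T) =
    ⋖-cong {X = prodT m} {s i j · T} {prodT ((i , j) ∷ m)} {T} m≈sT gm≈T cover , covers , m≈sT
    where
    m≈sT : prodT m ≈ s i j · T
    m≈sT x = trans (sym (s-involutive i j _)) (cong (s i j ∙_) (gm≈T x))

  IsChain-∷ : ∀ (T : Permutation′ n) g m → (s[ g ] · T) ⋖ T → IsChain (s[ g ] · T) m → IsChain T (g ∷ m)
  IsChain-∷ T (i , j) m cover (covers , m≈sT) =
    (⋖-cong {X = s i j · T} {prodT m} {T} {prodT ((i , j) ∷ m)} (sym ∘ m≈sT)
            (sym ∘ gm≈T) cover , covers) , gm≈T
    where
    gm≈T : prodT ((i , j) ∷ m) ≈ T
    gm≈T x = trans (cong (s i j ∙_) (m≈sT x)) (s-involutive i j _)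

  len-Covers : ∀ (m : Mono n) → Covers m → len (prodT m) ≡ length m
  len-Covers [] _ = len-id {n}
  len-Covers (g ∷ m) ((len-suc , _) , covers) = trans (sym len-suc) (cong suc (len-Covers m covers))

  IsChain-id : ∀ {m} → IsChain id m → m ≡ []
  IsChain-id {[]} _ = refl
  IsChain-id {g ∷ m} (covers , m≈id) =
    ⊥-elim (ℕP.0≢1+n (trans (sym (len-id {n}))
                     (trans (sym (len-cong {u = prodT (g ∷ m)} {v = id} m≈id)) (len-Covers (g ∷ m) covers))))

-- Integer equality is decidable, so it may be proved by cases on an undecided proposition.
≡-byCases : ∀ {p} {A : Set p} {x y : ℤ} → (A → x ≡ y) → (¬ A → x ≡ y) → x ≡ y
≡-byCases {x = x} {y} f g = decidable-stable (x ℤ.≟ y) λ x≢y → x≢y (g (x≢y ∘ f))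

opposite-terms-cancel : ∀ σ c w → σ ℤ.* (c ℤ.* w) ℤ.+ c ℤ.* (- σ) ℤ.* w ≡ 0ℤ
opposite-terms-cancel = solve-∀

module ChainFunctionals {n : ℕ} (a a' : Fin n) (a'≡1+a : toℕ a' ≡ suc (toℕ a)) where
  open Adjacent a a' a'≡1+a
  open Lifting a a' a'≡1+a
  open Pairing {n}

  IsXₐ : Gen n → Set
  IsXₐ (i , j) = (i ≡ a × j ≡ a') ⊎ (i ≡ a' × j ≡ a)

  isXₐ? : ∀ g → Dec (IsXₐ g)
  isXₐ? (i , j) = ((i FP.≟ a) ×-dec (j FP.≟ a')) ⊎-dec ((i FP.≟ a') ×-dec (j FP.≟ a))

  s∙a≡a'⇒IsXₐ : ∀ {i j} → s i j ∙ a ≡ a' → IsXₐ (i , j)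
  s∙a≡a'⇒IsXₐ {i} {j} sa≡a' with transposeView i j a
  ... | at-i a≡i = inj₁ (sym a≡i , trans (sym (s-at-i i j)) (trans (cong (s i j ∙_) (sym a≡i)) sa≡a'))
  ... | at-j _ a≡j = inj₂ (trans (sym (s-at-j i j)) (trans (cong (s i j ∙_) (sym a≡j)) sa≡a') , sym a≡j)
  ... | away a≢i a≢j = ⊥-elim (a≢a' (trans (sym (s-away i j a a≢i a≢j)) sa≡a'))

  s[]·≈sₐ·⇒IsXₐ : ∀ g Z → s[ g ] · Z ≈ sₐ · Z → IsXₐ g
  s[]·≈sₐ·⇒IsXₐ (i , j) Z sZ≈sₐZ = s∙a≡a'⇒IsXₐ (begin
    s i j ∙ a              ≡⟨ cong (s i j ∙_) (Perm.inverseʳ Z) ⟨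
    s i j ∙ Z ∙ (Z ⁻¹) ∙ a ≡⟨ sZ≈sₐZ _ ⟩
    sₐ ∙ Z ∙ (Z ⁻¹) ∙ a    ≡⟨ cong (sₐ ∙_) (Perm.inverseʳ Z) ⟩
    sₐ ∙ a                 ≡⟨ s-at-i a a' ⟩
    a'                     ∎)
    where open ≡-Reasoning

  IsXₐ⇒s[]·≈sₐ· : ∀ {g} → IsXₐ g → ∀ Z → s[ g ] · Z ≈ sₐ · Z
  IsXₐ⇒s[]·≈sₐ· (inj₁ (refl , refl)) Z x = refl
  IsXₐ⇒s[]·≈sₐ· (inj₂ (refl , refl)) Z x = s-comm a' a (Z ∙ x)

  s[sₐ]·sₐ· : ∀ g Z → s[ actGen sₐ g ] · (sₐ · Z) ≈ sₐ · (s[ g ] · Z)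
  s[sₐ]·sₐ· (i , j) Z x = trans (s-conjugate sₐ (sₐ ∙ i) (sₐ ∙ j) (Z ∙ x))
    (cong (sₐ ∙_) (cong₂ (λ k l → s k l ∙ Z ∙ x) (Perm.inverseˡ sₐ) (Perm.inverseˡ sₐ)))

  δ-IsXₐ : ∀ {g} → IsXₐ g → δ a a' g ≡ sign g
  δ-IsXₐ (inj₁ (refl , refl)) rewrite eqF-true (refl {x = a}) | eqF-true (refl {x = a'}) = sym (sign-< a<a')
  δ-IsXₐ (inj₂ (refl , refl))
    rewrite eqF-∧-false {i = a'} {a} {a} {a'} (λ (a'≡a , _) → a≢a' (sym a'≡a))
          | eqF-true (refl {x = a}) | eqF-true (refl {x = a'}) = sym (sign-> a<a')

  δ-¬IsXₐ : ∀ {g} → ¬ IsXₐ g → δ a a' g ≡ 0ℤ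
  δ-¬IsXₐ {i , j} ¬x rewrite eqF-∧-false {i = i} {j} {a} {a'} (¬x ∘ inj₁)
                           | eqF-∧-false {i = i} {j} {a'} {a} (¬x ∘ inj₂) = refl

  sign-sₐ-IsXₐ : ∀ {g} → IsXₐ g → sign (actGen sₐ g) ≡ - sign g
  sign-sₐ-IsXₐ (inj₁ (refl , refl)) rewrite s-at-i a a' | s-at-j a a' | sign-< a<a' = sign-> a<a'
  sign-sₐ-IsXₐ (inj₂ (refl , refl)) rewrite s-at-i a a' | s-at-j a a' | sign-> a<a' = sign-< a<a'

  sign-sₐ-¬IsXₐ : ∀ {g} → ¬ IsXₐ g → sign (actGen sₐ g) ≡ sign g
  sign-sₐ-¬IsXₐ {i , j} ¬x = sign-cong
    (λ sj<si → subst₂ F._<_ (s-involutive a a' j) (s-involutive a a' i) (sₐ-preserves-< sj<si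
      λ (sj≡a , si≡a') → ¬x (inj₁ ( ∙-injective sₐ (trans si≡a' (sym (s-at-i a a')))
                                   , ∙-injective sₐ (trans sj≡a (sym (s-at-j a a')))))))
    (λ j<i → sₐ-preserves-< j<i λ (j≡a , i≡a') → ¬x (inj₂ (i≡a' , j≡a)))

  ChainFunctional : ℤ → Permutation′ n → (Mono n → ℤ) → Set
  ChainFunctional c T V = ∀ x → ChainWeight c T x (V x)

  evalΔ-zero : ∀ {V} m → (∀ x → V x ≡ 0ℤ) → evalΔ a a' V m ≡ 0ℤ
  evalΔ-zero [] V≡0 = refl
  evalΔ-zero {V} (g ∷ m) V≡0 = begin
    δ a a' g ℤ.* V m ℤ.+ evalΔ a a' _ m
      ≡⟨ cong₂ (λ v t → δ a a' g ℤ.* v ℤ.+ t) (V≡0 m) (evalΔ-zero m (V≡0 ∘ (_ ∷_))) ⟩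
    δ a a' g ℤ.* 0ℤ ℤ.+ 0ℤ
      ≡⟨ trans (ℤP.+-identityʳ _) (ℤP.*-zeroʳ (δ a a' g)) ⟩
    0ℤ ∎
    where open ≡-Reasoning

  EvalΔChains : Mono n → Set
  EvalΔChains m = ∀ V c Z → ChainFunctional c (sₐ · Z) V →
    (Descent Z → ChainWeight c Z m (evalΔ a a' V m)) × (¬ Descent Z → evalΔ a a' V m ≡ 0ℤ)

  module Step (g : Gen n) (m : Mono n) (ih : EvalΔChains m) {V : Mono n → ℤ} {c : ℤ}
              (Z : Permutation′ n) (hV : ChainFunctional c (sₐ · Z) V) where

    Z₁ : Permutation′ n
    Z₁ = s[ g ] · Z

    g' : Gen n
    g' = actGen sₐ g

    σ σ' w c' : ℤ
    σ = sign g
    σ' = sign g'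
    w = wordSign m
    c' = c ℤ.* σ'

    V' : Mono n → ℤ
    V' = V ∘ (g' ∷_)

    tail : ℤ
    tail = evalΔ a a' V' m

    Lower : Set
    Lower = (sₐ · Z₁) ⋖ (sₐ · Z)

    conj : s[ g' ] · (sₐ · Z) ≈ sₐ · Z₁
    conj = s[sₐ]·sₐ· g Z

    V'-chains : Lower → ChainFunctional c' (sₐ · Z₁) V'
    V'-chains lower x = chain , ¬chain
      where
      chain : IsChain (sₐ · Z₁) x → V' x ≡ c' ℤ.* wordSign x
      chain ch = trans (proj₁ (hV (g' ∷ x)) (IsChain-∷ (sₐ · Z) g' x lower' ch'))
                       (sym (ℤP.*-assoc c σ' (wordSign x)))
        where
        lower' = ⋖-cong {X = sₐ · Z₁} {s[ g' ] · (sₐ · Z)} {sₐ · Z} {sₐ · Z} (sym ∘ conj) (λ _ → refl) lower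
        ch' = IsChain-cong {T = sₐ · Z₁} {s[ g' ] · (sₐ · Z)} (sym ∘ conj) ch
      ¬chain : ¬ IsChain (sₐ · Z₁) x → V' x ≡ 0ℤ
      ¬chain ¬ch = proj₂ (hV (g' ∷ x)) λ ch →
        ¬ch (IsChain-cong {T = s[ g' ] · (sₐ · Z)} {sₐ · Z₁} conj (proj₂ (IsChain-∷⁻ (sₐ · Z) g' x ch)))

    tail-no-lower : ¬ Lower → tail ≡ 0ℤ
    tail-no-lower ¬lower = evalΔ-zero m λ x → proj₂ (hV (g' ∷ x)) λ ch →
      ¬lower (⋖-cong {X = s[ g' ] · (sₐ · Z)} {sₐ · Z₁} {sₐ · Z} {sₐ · Z} conj (λ _ → refl)
                     (proj₁ (IsChain-∷⁻ (sₐ · Z) g' x ch)))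

    tail-ascent : ¬ Descent Z₁ → tail ≡ 0ℤ
    tail-ascent ¬dZ₁ = ≡-byCases (λ lower → proj₂ (ih V' c' Z₁ (V'-chains lower)) ¬dZ₁) tail-no-lower

    tail-descent : Descent Z₁ → Lower → ChainWeight c' Z₁ m tail
    tail-descent dZ₁ lower = proj₁ (ih V' c' Z₁ (V'-chains lower)) dZ₁

    total-IsXₐ : IsXₐ g → evalΔ a a' V (g ∷ m) ≡ σ ℤ.* V m ℤ.+ tail
    total-IsXₐ x = cong (λ d → d ℤ.* V m ℤ.+ tail) (δ-IsXₐ x)

    total-¬IsXₐ : ¬ IsXₐ g → evalΔ a a' V (g ∷ m) ≡ tail
    total-¬IsXₐ ¬x = begin
      δ a a' g ℤ.* V m ℤ.+ tail ≡⟨ cong (λ d → d ℤ.* V m ℤ.+ tail) (δ-¬IsXₐ ¬x) ⟩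
      0ℤ ℤ.* V m ℤ.+ tail       ≡⟨ cong (ℤ._+ tail) (ℤP.*-zeroˡ (V m)) ⟩
      0ℤ ℤ.+ tail               ≡⟨ ℤP.+-identityˡ tail ⟩
      tail                      ∎
      where open ≡-Reasoning

    σ*0+0 : σ ℤ.* 0ℤ ℤ.+ 0ℤ ≡ 0ℤ
    σ*0+0 = trans (ℤP.+-identityʳ _) (ℤP.*-zeroʳ σ)

    Z₁≈sₐZ : IsXₐ g → Z₁ ≈ sₐ · Z
    Z₁≈sₐZ x = IsXₐ⇒s[]·≈sₐ· x Z

    descent : Descent Z → ChainWeight c Z (g ∷ m) (evalΔ a a' V (g ∷ m))
    descent dZ with descent? Z₁ | isXₐ? g
    ... | yes dZ₁ | yes x = ⊥-elim (ascent⇒¬descent {sₐ · Z} (descent⇒ascent-sₐ· Z dZ)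
                                      (Descent-cong {u = Z₁} {v = sₐ · Z} (Z₁≈sₐZ x) dZ₁))
    ... | yes dZ₁ | no ¬x = chain , ¬chain
      where
      chain : IsChain Z (g ∷ m) → evalΔ a a' V (g ∷ m) ≡ c ℤ.* wordSign (g ∷ m)
      chain ch = let cover , chZ₁ = IsChain-∷⁻ Z g m ch in begin
        evalΔ a a' V (g ∷ m)  ≡⟨ total-¬IsXₐ ¬x ⟩
        tail                  ≡⟨ proj₁ (tail-descent dZ₁ (sₐ·-⋖ {Z₁} {Z} dZ₁ dZ cover)) chZ₁ ⟩
        c ℤ.* σ' ℤ.* w        ≡⟨ cong (λ τ → c ℤ.* τ ℤ.* w) (sign-sₐ-¬IsXₐ ¬x) ⟩
        c ℤ.* σ ℤ.* w         ≡⟨ ℤP.*-assoc c σ w ⟩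
        c ℤ.* (σ ℤ.* w)       ∎
        where open ≡-Reasoning
      ¬chain : ¬ IsChain Z (g ∷ m) → evalΔ a a' V (g ∷ m) ≡ 0ℤ
      ¬chain ¬ch = trans (total-¬IsXₐ ¬x) (≡-byCases
        (λ lower → proj₂ (tail-descent dZ₁ lower) (¬ch ∘ IsChain-∷ Z g m (sₐ·-⋖⁻ {Z₁} {Z} dZ₁ dZ lower)))
        tail-no-lower)
    ... | no ¬dZ₁ | yes x = chain , ¬chain
      where
      open ≡-Reasoning
      cover : Z₁ ⋖ Z
      cover = ⋖-cong {X = sₐ · Z} {Z₁} {Z} {Z} (sym ∘ Z₁≈sₐZ x) (λ _ → refl) (sₐ·⋖ {Z} dZ)
      chain : IsChain Z (g ∷ m) → evalΔ a a' V (g ∷ m) ≡ c ℤ.* wordSign (g ∷ m)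
      chain ch = begin
        evalΔ a a' V (g ∷ m)       ≡⟨ total-IsXₐ x ⟩
        σ ℤ.* V m ℤ.+ tail         ≡⟨ cong₂ (λ v t → σ ℤ.* v ℤ.+ t) Vm (tail-ascent ¬dZ₁) ⟩
        σ ℤ.* (c ℤ.* w) ℤ.+ 0ℤ     ≡⟨ ℤP.+-identityʳ _ ⟩
        σ ℤ.* (c ℤ.* w)            ≡⟨ x∙yz≈y∙xz σ c w ⟩
        c ℤ.* (σ ℤ.* w)            ∎
        where
        Vm : V m ≡ c ℤ.* w
        Vm = proj₁ (hV m) (IsChain-cong {T = Z₁} {sₐ · Z} (Z₁≈sₐZ x) (proj₂ (IsChain-∷⁻ Z g m ch)))
      ¬chain : ¬ IsChain Z (g ∷ m) → evalΔ a a' V (g ∷ m) ≡ 0ℤ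
      ¬chain ¬ch = begin
        evalΔ a a' V (g ∷ m)  ≡⟨ total-IsXₐ x ⟩
        σ ℤ.* V m ℤ.+ tail    ≡⟨ cong₂ (λ v t → σ ℤ.* v ℤ.+ t) Vm (tail-ascent ¬dZ₁) ⟩
        σ ℤ.* 0ℤ ℤ.+ 0ℤ       ≡⟨ σ*0+0 ⟩
        0ℤ                    ∎
        where
        Vm : V m ≡ 0ℤ
        Vm = proj₂ (hV m) λ ch →
          ¬ch (IsChain-∷ Z g m cover (IsChain-cong {T = sₐ · Z} {Z₁} (sym ∘ Z₁≈sₐZ x) ch))
    ... | no ¬dZ₁ | no ¬x =
      (λ ch → ⊥-elim (¬x (s[]·≈sₐ·⇒IsXₐ g Z (lifting {Z₁} {Z} (proj₁ (IsChain-∷⁻ Z g m ch)) ¬dZ₁ dZ)))) ,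
      (λ _ → trans (total-¬IsXₐ ¬x) (tail-ascent ¬dZ₁))

    ascent : ¬ Descent Z → evalΔ a a' V (g ∷ m) ≡ 0ℤ
    ascent ¬dZ with descent? Z₁ | isXₐ? g
    ... | yes dZ₁ | yes x = trans (total-IsXₐ x) (≡-byCases {A = IsChain Z₁ m}
      (λ ch → begin
        σ ℤ.* V m ℤ.+ tail                    ≡⟨ cong₂ (λ v t → σ ℤ.* v ℤ.+ t) (proj₁ Vm ch) (proj₁ tailw ch) ⟩
        σ ℤ.* (c ℤ.* w) ℤ.+ c ℤ.* σ' ℤ.* w    ≡⟨ cong (λ τ → σ ℤ.* (c ℤ.* w) ℤ.+ c ℤ.* τ ℤ.* w)
                                                      (sign-sₐ-IsXₐ x) ⟩
        σ ℤ.* (c ℤ.* w) ℤ.+ c ℤ.* (- σ) ℤ.* w ≡⟨ opposite-terms-cancel σ c w ⟩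
        0ℤ                                    ∎)
      (λ ¬ch → begin
        σ ℤ.* V m ℤ.+ tail  ≡⟨ cong₂ (λ v t → σ ℤ.* v ℤ.+ t) (proj₂ Vm ¬ch) (proj₂ tailw ¬ch) ⟩
        σ ℤ.* 0ℤ ℤ.+ 0ℤ     ≡⟨ σ*0+0 ⟩
        0ℤ                  ∎))
      where
      open ≡-Reasoning
      Vm : ChainWeight c Z₁ m (V m)
      Vm = ChainWeight-cong {c = c} {T = sₐ · Z} {Z₁} (sym ∘ Z₁≈sₐZ x) (hV m)
      lower : Lower
      lower = ⋖-cong {X = sₐ · (sₐ · Z)} {sₐ · Z₁} {sₐ · Z} {sₐ · Z}
                (λ y → cong (sₐ ∙_) (sym (Z₁≈sₐZ x y))) (λ _ → refl)
                (sₐ·⋖ {sₐ · Z} (ascent⇒descent-sₐ· Z (¬descent⇒ascent Z ¬dZ)))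
      tailw : ChainWeight c' Z₁ m tail
      tailw = tail-descent dZ₁ lower
    ... | yes dZ₁ | no ¬x = trans (total-¬IsXₐ ¬x) (tail-no-lower λ lower → ¬x (s[]·≈sₐ·⇒IsXₐ g Z λ y →
      let sₐZ₁≈sₐsₐZ = lifting {sₐ · Z₁} {sₐ · Z} lower
                         (ascent⇒¬descent {sₐ · Z₁} (descent⇒ascent-sₐ· Z₁ dZ₁))
                         (ascent⇒descent-sₐ· Z (¬descent⇒ascent Z ¬dZ))
      in trans (sym (s-involutive a a' _)) (trans (cong (sₐ ∙_) (sₐZ₁≈sₐsₐZ y)) (s-involutive a a' _))))
    ... | no ¬dZ₁ | yes x = ⊥-elim (¬dZ₁ (Descent-cong {u = sₐ · Z} {v = Z₁} (sym ∘ Z₁≈sₐZ x)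
                                           (ascent⇒descent-sₐ· Z (¬descent⇒ascent Z ¬dZ))))
    ... | no ¬dZ₁ | no ¬x = trans (total-¬IsXₐ ¬x) (tail-ascent ¬dZ₁)

  evalΔ-chains : ∀ m → EvalΔChains m
  evalΔ-chains [] V c Z hV = (λ dZ → (λ ch → ⊥-elim (¬chain-[] dZ ch)) , (λ _ → refl)) , (λ _ → refl)
    where
    ¬chain-[] : Descent Z → ¬ IsChain Z []
    ¬chain-[] dZ (_ , id≈Z) = ℕP.0≢1+n (begin
      0                 ≡⟨ len-id {n} ⟨
      len (id {n})      ≡⟨ len-cong {u = id} {v = Z} id≈Z ⟩
      len Z             ≡⟨ len-sₐ·-descent Z dZ ⟨
      suc (len (sₐ · Z)) ∎)
      where open ≡-Reasoning
  evalΔ-chains (g ∷ m) V c Z hV =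
    Step.descent g m (evalΔ-chains m) {V} {c} Z hV , Step.ascent g m (evalΔ-chains m) {V} {c} Z hV

-- Reduced words and the theorem

Reduced : ∀ {n} → Mono n → Set
Reduced W = All Adjacent W × (len (prodT W) ≡ length W)

prodT-∷ʳ : ∀ {n} (W : Mono n) (i j : Fin n) → prodT (W ∷ʳ (i , j)) ≈ prodT W · s i j
prodT-∷ʳ [] i j x = refl
prodT-∷ʳ ((k , l) ∷ W) i j x = cong (s k l ∙_) (prodT-∷ʳ W i j x)

len-prodT-≤ : ∀ {n} (W : Mono n) → All Adjacent W → len (prodT W) ≤ length W
len-prodT-≤ {n} [] _ = ℕP.≤-reflexive (len-id {n})
len-prodT-≤ ((i , j) ∷ W) (adj ∷ adjs) =
  ℕP.≤-trans (Adjacent.len-sₐ·-≤ i j adj (prodT W)) (s≤s (len-prodT-≤ W adjs))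

Reduced-covers : ∀ {n} (W : Mono n) → Reduced W → Covers W
Reduced-covers [] _ = _
Reduced-covers ((i , j) ∷ W) (adj ∷ adjs , len-W) = cover , Reduced-covers W (adjs , len-u)
  where
  open Adjacent i j adj using (len-sₐ·-≤; a≢a'; sₐ·sₐ·)
  u = prodT W
  len-u : len u ≡ length W
  len-u = ℕP.≤-antisym (len-prodT-≤ W adjs) (ℕP.≤-pred (subst (_≤ suc (len u)) len-W (len-sₐ·-≤ u)))
  len-sₐsₐu : suc (len (s i j · (s i j · u))) ≡ len (s i j · u)
  len-sₐsₐu = trans (cong suc (trans (len-cong {u = s i j · (s i j · u)} {v = u} (sₐ·sₐ· u)) len-u)) (sym len-W)
  cover : u ⋖ (s i j · u)
  cover = ⋖-cong {X = s i j · (s i j · u)} {u} {s i j · u} {s i j · u} (sₐ·sₐ· u) (λ _ → refl)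
                 (s·⋖ (s i j · u) a≢a' len-sₐsₐu)

module _ {n : ℕ} {W : Mono n} {a a' : Fin n} (adj : toℕ a' ≡ suc (toℕ a))
         (red : Reduced (W ∷ʳ (a , a'))) where
  open Adjacent a a' adj

  sₐ·prodT-∷ʳ⁻¹ : sₐ · (prodT (W ∷ʳ (a , a')) ⁻¹) ≈ prodT W ⁻¹
  sₐ·prodT-∷ʳ⁻¹ x =
    trans (cong (sₐ ∙_) (⁻¹-cong {u = prodT (W ∷ʳ (a , a'))} {v = prodT W · sₐ} (prodT-∷ʳ W a a') x))
          (PC.transpose-inverse a a')

  private
    len-∷ʳ : len (prodT (W ∷ʳ (a , a'))) ≡ suc (length W)
    len-∷ʳ = trans (proj₂ red) (trans (LP.length-++ W) (ℕP.+-comm (length W) 1))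

    len-W≤ : len (prodT W) ≤ length W
    len-W≤ = len-prodT-≤ W (proj₁ (AllP.∷ʳ⁻ (proj₁ red)))

  Reduced-init : Reduced W
  Reduced-init = proj₁ (AllP.∷ʳ⁻ (proj₁ red)) , ℕP.≤-antisym len-W≤ (ℕP.≤-pred (begin
    suc (length W)                     ≡⟨ len-∷ʳ ⟨
    len (prodT (W ∷ʳ (a , a')))        ≡⟨ len-cong {u = prodT (W ∷ʳ (a , a'))} {v = prodT W · sₐ} (prodT-∷ʳ W a a') ⟩
    len (prodT W · sₐ)                 ≤⟨ len-·sₐ-≤ (prodT W) ⟩
    suc (len (prodT W))                ∎))
    where open ℕP.≤-Reasoning

  Reduced-∷ʳ-descent : Descent (prodT (W ∷ʳ (a , a')) ⁻¹)
  Reduced-∷ʳ-descent with descent? (prodT (W ∷ʳ (a , a')) ⁻¹)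
  ... | yes desc = desc
  ... | no ¬desc = ⊥-elim (ℕP.<-irrefl refl (ℕP.≤-trans (begin
    suc (suc (length W))  ≡⟨ cong suc len-∷ʳ ⟨
    suc (len u)           ≡⟨ cong suc (len-⁻¹ u) ⟨
    suc (len (u ⁻¹))      ≡⟨ len-sₐ·-ascent (u ⁻¹) (¬descent⇒ascent (u ⁻¹) ¬desc) ⟩
    len (sₐ · (u ⁻¹))     ≡⟨ len-cong {u = sₐ · (u ⁻¹)} {v = prodT W ⁻¹} sₐ·prodT-∷ʳ⁻¹ ⟩
    len (prodT W ⁻¹)      ≡⟨ len-⁻¹ (prodT W) ⟩
    len (prodT W)         ∎) (ℕP.m≤n⇒m≤1+n len-W≤)))
    where
    open ℕP.≤-Reasoning
    u = prodT (W ∷ʳ (a , a'))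

pairing-reduced : ∀ {n} {W : Mono n} → Reverse W → Reduced W →
                  ∀ P → ChainWeight 1ℤ (prodT W ⁻¹) P ⟨ W , P ⟩
pairing-reduced [] _ [] = (λ _ → refl) , (λ ¬ch → ⊥-elim (¬ch (_ , λ _ → refl)))
pairing-reduced [] _ (g ∷ P) =
  (λ ch → case IsChain-id (IsChain-cong {T = id ⁻¹} {id} (λ _ → refl) ch) of λ ()) , (λ _ → refl)
pairing-reduced (W ∶ rW ∶ʳ (a , a')) red P =
  subst (ChainWeight 1ℤ Z P) (sym (⟨⟩-∷ʳ a a' W P))
        (proj₁ (evalΔ-chains P ⟨ W ,_⟩ 1ℤ Z chains) (Reduced-∷ʳ-descent adj red))
  where
  adj = proj₂ (AllP.∷ʳ⁻ (proj₁ red))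
  open Adjacent a a' adj using (sₐ)
  open ChainFunctionals a a' adj using (evalΔ-chains; ChainFunctional)
  open Pairing using (⟨⟩-∷ʳ)
  Z = prodT (W ∷ʳ (a , a')) ⁻¹
  chains : ChainFunctional 1ℤ (sₐ · Z) ⟨ W ,_⟩
  chains x = ChainWeight-cong {c = 1ℤ} {T = prodT W ⁻¹} {sₐ · Z}
    (sym ∘ sₐ·prodT-∷ʳ⁻¹ adj red) (pairing-reduced rW (Reduced-init adj red) x)

ReducedWord⇒Reduced : ∀ {n} {w : Permutation′ n} {W : Mono n} → ReducedWord w W → Reduced W
ReducedWord⇒Reduced {w = w} {W} (adjs , W≈w , length≡len) =
  adjs , trans (len-cong {u = prodT W} {v = w} W≈w) (sym length≡len)

Adjacent⇒IncreasingPairs : ∀ {n} (W : Mono n) → All Adjacent W → IncreasingPairs W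
Adjacent⇒IncreasingPairs [] [] = []
Adjacent⇒IncreasingPairs ((i , j) ∷ W) (adj ∷ adjs) =
  subst (toℕ i ℕ.<_) (sym adj) (ℕP.n<1+n (toℕ i)) ∷ Adjacent⇒IncreasingPairs W adjs

pairing-xw : ∀ {n : ℕ} (w : Permutation′ n) (xw : Mono n) → ReducedWord w xw →
  (P : Mono n) → IncreasingPairs P →
  (SatChain w P → ⟨ xw , P ⟩ ≡ 1ℤ) × (¬ SatChain w P → ⟨ xw , P ⟩ ≡ 0ℤ)
pairing-xw w xw rw P inc =
  (λ sat → trans (proj₁ weight sat) (cong (1ℤ ℤ.*_) (wordSign-increasing P inc))) , proj₂ weight
  where
  weight : ChainWeight 1ℤ (w ⁻¹) P ⟨ xw , P ⟩
  weight = ChainWeight-cong {c = 1ℤ} {T = prodT xw ⁻¹} {w ⁻¹} (⁻¹-cong {u = prodT xw} {v = w} (proj₁ (proj₂ rw)))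
             (pairing-reduced (reverseView xw) (ReducedWord⇒Reduced {w = w} rw) P)

pairing-xv-xw : ∀ {n : ℕ} (v w : Permutation′ n) (xv xw : Mono n) → ReducedWord v xv → ReducedWord w xw →
  (w ≈ v ⁻¹ → ⟨ xv , xw ⟩ ≡ 1ℤ) × (¬ (w ≈ v ⁻¹) → ⟨ xv , xw ⟩ ≡ 0ℤ)
pairing-xv-xw v w xv xw rv rw@(adjs , xw≈w , _) =
  (λ w≈v⁻¹ → proj₁ pairing (covers , λ x → trans (xw≈w x) (w≈v⁻¹ x))) ,
  (λ w≉v⁻¹ → proj₂ pairing λ (_ , xw≈v⁻¹) → w≉v⁻¹ λ x → trans (sym (xw≈w x)) (xw≈v⁻¹ x))
  where
  pairing = pairing-xw v xv rv xw (Adjacent⇒IncreasingPairs xw adjs)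
  covers = Reduced-covers xw (ReducedWord⇒Reduced {w = w} rw)

proposition3p2 : (∀ {n : ℕ} (w : Permutation′ n) (xw : Mono n) → ReducedWord w xw →
       (P : Mono n) → IncreasingPairs P →
       (SatChain w P → ⟨ xw , P ⟩ ≡ 1ℤ) × (¬ SatChain w P → ⟨ xw , P ⟩ ≡ 0ℤ))
    ×
    (∀ {n : ℕ} (v w : Permutation′ n) (xv xw : Mono n) → ReducedWord v xv → ReducedWord w xw →
       (w ≈ v ⁻¹ → ⟨ xv , xw ⟩ ≡ 1ℤ) × (¬ (w ≈ v ⁻¹) → ⟨ xv , xw ⟩ ≡ 0ℤ))
proposition3p2 = (λ {n} → pairing-xw {n}) , (λ {n} → pairing-xv-xw {n})
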